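{- OBFOL is incomparable in expressive power with the clique-guarded fragment CGFOL and with the guarded-negation fragment GNFOL: there exists an OBFOL sentence that is equivalent to no CGFOL sentence and to no GNFOL sentence, and there exists a sentence belonging to both CGFOL and GNFOL (indeed a guarded sentence) that is equivalent to no OBFOL sentence.
   Context: Language signature $\Sigma=(\mathrm{Args},\mathrm{Rels},\mathrm{ar})$: $\mathrm{Args},\mathrm{Rels}$ finite non-empty, $\mathrm{ar}:\mathrm{Rels}\to\mathcal P(\mathrm{Args})\setminus\{\emptyset\}$. A $\Sigma$-structure $\mathcal R=(D,\cdot^{\mathcal R})$: $D$ non-empty, $r^{\mathcal R}$ a set of functions $\mathrm{ar}(r)\to D$. FOL formulas: $\varphi::= r\mid\neg\varphi\mid\varphi\wedge\varphi\mid\varphi\vee\varphi\mid\exists x.\varphi\mid\forall x.\varphi\mid(a,x)\varphi$, with semantics over partial assignments $\chi:\mathrm{Args}\cup\mathrm{Var}\rightharpoonup D$: $\mathcal R,\chi\models r$ iff $\chi|_{\mathrm{ar}(r)}\in r^{\mathcal R}$, usual Boolean/quantifier clauses, $\mathcal R,\chi\models(a,x)\varphi$ iff $\mathcal R,\chi[a\mapsto\chi(x)]\models\varphi$; a sentence has no free arguments or variables, and $\mathcal R\models\varphi$ iff $\mathcal R,\emptyset\models\varphi$. Fixing an order on the arguments of each relation, such formulas correspond exactly to classical relational first-order formulas ($(a_1,x_1)\cdots(a_m,x_m)r$ corresponds to $r(x_1,\dots,x_m)$), and conversely; equivalence of sentences means having the same models. Quantification prefix: finite word over $\{\exists x,\forall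 x\}$, each variable at most once; binding prefix: finite word over pairs $(a,x)$, each argument at most once; derived relation: Boolean combination of relations all with the same argument set. OBFOL formulas: $\varphi::=\wp\flat\bar r\mid(\varphi\wedge\varphi)\mid(\varphi\vee\varphi)$. CGFOL is the clique-guarded fragment of first-order logic (Grädel): quantification only of the form $\exists\bar y(\gamma(\bar x,\bar y)\wedge\phi)$ / $\forall\bar y(\gamma(\bar x,\bar y)\to\phi)$ where $\gamma$ is a clique-formula (an existentially quantified conjunction of atoms in which every two of its free variables co-occur in some atom) whose free variables include all free variables of $\phi$; it contains the guarded fragment, where $\gamma$ is a single atom. GNFOL is the guarded-negation fragment (Bárány, ten Cate, Segoufin): $\phi::=R(\bar x)\mid x=y\mid\exists x\phi\mid\phi\wedge\phi\mid\phi\vee\phi\mid\alpha\wedge\neg\phi$, with $\alpha$ an atomic formula containing all free variables of $\phi$. -}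

module Defs where

open import Level using (0ℓ)
open import Data.Nat using (ℕ)
open import Data.Fin using (Fin)
open import Data.Fin.Subset using (Subset; _∈_; Nonempty)
open import Data.Maybe using (Maybe; just; nothing)
open import Data.Product using (Σ; _×_; _,_; proj₁; proj₂)
open import Data.Sum using (_⊎_)
open import Data.Empty using (⊥)
open import Data.Unit using (⊤)
open import Data.List using (List; []; _∷_; map)
open import Data.List.Relation.Unary.Unique.Propositional using (Unique)
open import Relation.Nullary using (¬_)
open import Relation.Binary.PropositionalEquality using (_≡_; _≢_)
open import Relation.Nullary.Decidable using (does)
open import Data.Fin using () renaming (_≟_ to _≟ᶠ_)
open import Data.Nat using () renaming (_≟_ to _≟ⁿ_)
open import Data.Bool using (if_then_else_)

record Signature : Set where
  field
    nA     : ℕ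
    nR     : ℕ
    arg₀   : Fin nA
    rel₀   : Fin nR
    ar     : Fin nR → Subset nA
    ar-ne  : ∀ r → Nonempty (ar r)

Var : Set
Var = ℕ

module _ (S : Signature) where
  open Signature S

  Args : Set
  Args = Fin nA

  Rels : Set
  Rels = Fin nR

  ArgsOf : Rels → Set
  ArgsOf r = Σ Args (λ a → a ∈ ar r)

  record Structure : Set₁ where
    field
      D      : Set
      d₀     : D
      relI   : (r : Rels) → (ArgsOf r → D) → Set
      relI-ext : ∀ r (f g : ArgsOf r → D) → (∀ i → f i ≡ g i) → relI r f → relI r g

  data Fm : Set where
    rel  : Rels → Fm
    neg  : Fm → Fm
    and  : Fm → Fm → Fm
    or   : Fm → Fm → Fm
    ex   : Var → Fm → Fm
    all  : Var → Fm → Fm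
    bind : Args → Var → Fm → Fm

  FreeArg : Args → Fm → Set
  FreeArg a (rel r)      = a ∈ ar r
  FreeArg a (neg φ)      = FreeArg a φ
  FreeArg a (and φ ψ)    = FreeArg a φ ⊎ FreeArg a ψ
  FreeArg a (or φ ψ)     = FreeArg a φ ⊎ FreeArg a ψ
  FreeArg a (ex x φ)     = FreeArg a φ
  FreeArg a (all x φ)    = FreeArg a φ
  FreeArg a (bind b x φ) = a ≢ b × FreeArg a φ

  FreeVar : Var → Fm → Set
  FreeVar x (rel r)      = ⊥
  FreeVar x (neg φ)      = FreeVar x φ
  FreeVar x (and φ ψ)    = FreeVar x φ ⊎ FreeVar x ψ
  FreeVar x (or φ ψ)     = FreeVar x φ ⊎ FreeVar x ψ
  FreeVar x (ex y φ)     = x ≢ y × FreeVar x φ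
  FreeVar x (all y φ)    = x ≢ y × FreeVar x φ
  FreeVar x (bind b y φ) = x ≡ y ⊎ FreeVar x φ

  Sentence : Fm → Set
  Sentence φ = (∀ x → ¬ FreeVar x φ) × (∀ a → ¬ FreeArg a φ)

  record PAssign (D : Set) : Set where
    constructor ⟨_,_⟩
    field
      onArg : Args → Maybe D
      onVar : Var → Maybe D

  emptyPA : ∀ {D} → PAssign D
  emptyPA = ⟨ (λ _ → nothing) , (λ _ → nothing) ⟩

  setVar : ∀ {D} → PAssign D → Var → D → PAssign D
  setVar ⟨ α , β ⟩ x d = ⟨ α , (λ y → if does (y ≟ⁿ x) then just d else β y) ⟩

  -- χ[a ↦ χ(x)]  (a becomes undefined if χ(x) is undefined)
  setArg : ∀ {D} → PAssign D → Args → Maybe D → PAssign D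
  setArg ⟨ α , β ⟩ a m = ⟨ (λ b → if does (b ≟ᶠ a) then m else α b) , β ⟩

  module _ (R : Structure) where
    open Structure R

    Sat : PAssign D → Fm → Set
    Sat χ (rel r)      = Σ (ArgsOf r → D) λ f →
                           (∀ i → PAssign.onArg χ (proj₁ i) ≡ just (f i)) × relI r f
    Sat χ (neg φ)      = ¬ Sat χ φ
    Sat χ (and φ ψ)    = Sat χ φ × Sat χ ψ
    Sat χ (or φ ψ)     = Sat χ φ ⊎ Sat χ ψ
    Sat χ (ex x φ)     = Σ D λ d → Sat (setVar χ x d) φ
    Sat χ (all x φ)    = ∀ (d : D) → Sat (setVar χ x d) φ
    Sat χ (bind a x φ) = Sat (setArg χ a (PAssign.onVar χ x)) φ

    Models : Fm → Set
    Models φ = Sat emptyPA φ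

  data Quant : Set where
    ∃q ∀q : Quant

  QPrefix : Set
  QPrefix = List (Quant × Var)

  IsQPrefix : QPrefix → Set
  IsQPrefix p = Unique (map proj₂ p)

  applyQ : QPrefix → Fm → Fm
  applyQ []              φ = φ
  applyQ ((∃q , x) ∷ p)  φ = ex x (applyQ p φ)
  applyQ ((∀q , x) ∷ p)  φ = all x (applyQ p φ)

  BPrefix : Set
  BPrefix = List (Args × Var)

  IsBPrefix : BPrefix → Set
  IsBPrefix p = Unique (map proj₁ p)

  applyB : BPrefix → Fm → Fm
  applyB []             φ = φ
  applyB ((a , x) ∷ p)  φ = bind a x (applyB p φ)

  IsDerivedOn : Subset nA → Fm → Set
  IsDerivedOn A (rel r)   = ar r ≡ A
  IsDerivedOn A (neg φ)   = IsDerivedOn A φ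
  IsDerivedOn A (and φ ψ) = IsDerivedOn A φ × IsDerivedOn A ψ
  IsDerivedOn A (or φ ψ)  = IsDerivedOn A φ × IsDerivedOn A ψ
  IsDerivedOn A (ex _ _)  = ⊥
  IsDerivedOn A (all _ _) = ⊥
  IsDerivedOn A (bind _ _ _) = ⊥

  IsDerived : Fm → Set
  IsDerived φ = Σ (Subset nA) λ A → IsDerivedOn A φ

  data IsOBFOL : Fm → Set where
    basic : ∀ (℘ : QPrefix) (♭ : BPrefix) (r̄ : Fm) →
            IsQPrefix ℘ → IsBPrefix ♭ → IsDerived r̄ →
            IsOBFOL (applyQ ℘ (applyB ♭ r̄))
    and   : ∀ {φ ψ} → IsOBFOL φ → IsOBFOL ψ → IsOBFOL (and φ ψ)
    or    : ∀ {φ ψ} → IsOBFOL φ → IsOBFOL ψ → IsOBFOL (or φ ψ)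

  -- Classical relational FOL with equality over the same signature.
  -- An atom r(x̄) assigns a variable to each argument of r (this is
  -- r(x₁,…,xₘ) for any fixed order of ar(r)).

  data CFm : Set where
    atom : (r : Rels) → (ArgsOf r → Var) → CFm
    eq   : Var → Var → CFm
    neg  : CFm → CFm
    and  : CFm → CFm → CFm
    or   : CFm → CFm → CFm
    imp  : CFm → CFm → CFm
    ex   : Var → CFm → CFm
    all  : Var → CFm → CFm

  CFree : Var → CFm → Set
  CFree x (atom r v) = Σ (ArgsOf r) λ i → v i ≡ x
  CFree x (eq y z)   = x ≡ y ⊎ x ≡ z
  CFree x (neg φ)    = CFree x φ
  CFree x (and φ ψ)  = CFree x φ ⊎ CFree x ψ
  CFree x (or φ ψ)   = CFree x φ ⊎ CFree x ψ
  CFree x (imp φ ψ)  = CFree x φ ⊎ CFree x ψ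
  CFree x (ex y φ)   = x ≢ y × CFree x φ
  CFree x (all y φ)  = x ≢ y × CFree x φ

  CSentence : CFm → Set
  CSentence φ = ∀ x → ¬ CFree x φ

  module _ (R : Structure) where
    open Structure R

    upd : (Var → D) → Var → D → (Var → D)
    upd ρ x d y = if does (y ≟ⁿ x) then d else ρ y

    CSat : (Var → D) → CFm → Set
    CSat ρ (atom r v) = relI r (λ i → ρ (v i))
    CSat ρ (eq x y)   = ρ x ≡ ρ y
    CSat ρ (neg φ)    = ¬ CSat ρ φ
    CSat ρ (and φ ψ)  = CSat ρ φ × CSat ρ ψ
    CSat ρ (or φ ψ)   = CSat ρ φ ⊎ CSat ρ ψ
    CSat ρ (imp φ ψ)  = CSat ρ φ → CSat ρ ψ
    CSat ρ (ex x φ)   = Σ D λ d → CSat (upd ρ x d) φ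
    CSat ρ (all x φ)  = ∀ (d : D) → CSat (upd ρ x d) φ

    -- truth of a sentence (independent of the assignment)
    CModels : CFm → Set
    CModels φ = CSat (λ _ → d₀) φ

  exs : List Var → CFm → CFm
  exs []       φ = φ
  exs (y ∷ ys) φ = ex y (exs ys φ)

  alls : List Var → CFm → CFm
  alls []       φ = φ
  alls (y ∷ ys) φ = all y (alls ys φ)

  IsAtomic : CFm → Set
  IsAtomic (atom _ _) = ⊤
  IsAtomic (eq _ _)   = ⊤
  IsAtomic _          = ⊥

  AtomOf : CFm → CFm → Set
  AtomOf β (atom r v) = β ≡ atom r v
  AtomOf β (eq x y)   = β ≡ eq x y
  AtomOf β (and φ ψ)  = AtomOf β φ ⊎ AtomOf β ψ
  AtomOf β _          = ⊥

  IsConjAtoms : CFm → Set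
  IsConjAtoms (atom _ _) = ⊤
  IsConjAtoms (eq _ _)   = ⊤
  IsConjAtoms (and φ ψ)  = IsConjAtoms φ × IsConjAtoms ψ
  IsConjAtoms _          = ⊥

  IsCliqueFormula : CFm → Set
  IsCliqueFormula γ =
    Σ (List Var) λ zs → Σ CFm λ α → (γ ≡ exs zs α) × IsConjAtoms α ×
      (∀ x y → CFree x γ → CFree y γ →
         Σ CFm λ β → AtomOf β α × CFree x β × CFree y β)

  _⊆fv_ : CFm → CFm → Set
  φ ⊆fv γ = ∀ x → CFree x φ → CFree x γ

  data IsCGFOL : CFm → Set where
    atomic : ∀ {φ} → IsAtomic φ → IsCGFOL φ
    neg    : ∀ {φ} → IsCGFOL φ → IsCGFOL (neg φ)
    and    : ∀ {φ ψ} → IsCGFOL φ → IsCGFOL ψ → IsCGFOL (and φ ψ)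
    or     : ∀ {φ ψ} → IsCGFOL φ → IsCGFOL ψ → IsCGFOL (or φ ψ)
    imp    : ∀ {φ ψ} → IsCGFOL φ → IsCGFOL ψ → IsCGFOL (imp φ ψ)
    gex    : ∀ ys {γ φ} → IsCliqueFormula γ → φ ⊆fv γ → IsCGFOL φ →
             IsCGFOL (exs ys (and γ φ))
    gall   : ∀ ys {γ φ} → IsCliqueFormula γ → φ ⊆fv γ → IsCGFOL φ →
             IsCGFOL (alls ys (imp γ φ))

  data IsGFOL : CFm → Set where
    atomic : ∀ {φ} → IsAtomic φ → IsGFOL φ
    neg    : ∀ {φ} → IsGFOL φ → IsGFOL (neg φ)
    and    : ∀ {φ ψ} → IsGFOL φ → IsGFOL ψ → IsGFOL (and φ ψ)
    or     : ∀ {φ ψ} → IsGFOL φ → IsGFOL ψ → IsGFOL (or φ ψ)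
    imp    : ∀ {φ ψ} → IsGFOL φ → IsGFOL ψ → IsGFOL (imp φ ψ)
    gex    : ∀ ys {γ φ} → IsAtomic γ → φ ⊆fv γ → IsGFOL φ →
             IsGFOL (exs ys (and γ φ))
    gall   : ∀ ys {γ φ} → IsAtomic γ → φ ⊆fv γ → IsGFOL φ →
             IsGFOL (alls ys (imp γ φ))

  data IsGNFOL : CFm → Set where
    atom   : ∀ r v → IsGNFOL (atom r v)
    eq     : ∀ x y → IsGNFOL (eq x y)
    ex     : ∀ x {φ} → IsGNFOL φ → IsGNFOL (ex x φ)
    and    : ∀ {φ ψ} → IsGNFOL φ → IsGNFOL ψ → IsGNFOL (and φ ψ)
    or     : ∀ {φ ψ} → IsGNFOL φ → IsGNFOL ψ → IsGNFOL (or φ ψ)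
    gneg   : ∀ {α φ} → IsAtomic α → φ ⊆fv α → IsGNFOL φ →
             IsGNFOL (and α (neg φ))

  Equiv : Fm → CFm → Set₁
  Equiv φ ψ = ∀ (R : Structure) → (Models R φ → CModels R ψ) × (CModels R ψ → Models R φ)

-- OBFOL is incomparable with CGFOL and with GNFOL.  Both halves separate two
-- structures that agree on every sentence of one logic but not of the other.
--
-- (1) For any signature, the one-point structure with all relations full and
--     the "diagonal" structure on a set D (a tuple is in a relation iff it is
--     constant) agree on CGFOL and GNFOL: (clique-)guarded tuples of the
--     diagonal structure are constant, so guarded quantifiers and guarded
--     negations only see one element (Collapse).  The OBFOL sentence
--     ∀x ∀y (a,x)(b,y) R holds in the point but not on the diagonal of Bool.
-- (2) An OBFOL sentence is a positive combination of blocks whose relations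
--     share one argument set X, so structures with isomorphic X-reducts for
--     every X agree on OBFOL (Isomorphism).  On Bool, P = {true} with
--     R = {(true,true)} resp. R = {(false,false)} is such a pair (negation for
--     X = {a,b}, identity otherwise), separated by the guarded ∃x∃y(R(x,y) ∧ P(x)).

module Submission where

open import Defs
open import Data.Nat using () renaming (_≟_ to _≟ⁿ_)
open import Data.Bool using (Bool; true; false; not; if_then_else_)
open import Data.Bool.Properties using (not-involutive)
open import Data.Unit using (⊤; tt)
open import Data.Empty using (⊥-elim)
open import Data.Product using (Σ; _×_; _,_; proj₁; proj₂)
open import Data.Sum using (_⊎_; inj₁; inj₂)
open import Data.Fin using (Fin; zero; suc) renaming (_≟_ to _≟ᶠ_)
open import Data.Fin.Properties using (any?)
open import Data.Fin.Subset using (Subset; Nonempty; inside; outside) renaming (_∈_ to _∈ˢ_)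
open import Data.Fin.Subset.Properties using () renaming (_∈?_ to _∈ˢ?_)
open import Data.Vec using ([]; _∷_)
import Data.Vec.Base as Vec
open import Data.Vec.Properties.WithK using ([]=-irrelevant)
open import Data.List using (List; []; _∷_)
open import Data.List.Relation.Unary.Any using (here; there)
open import Data.List.Membership.Propositional using (_∈_; _∉_)
open import Data.List.Membership.DecPropositional _≟ⁿ_ using (_∈?_)
open import Data.List.Relation.Unary.AllPairs using ([]; _∷_)
open import Data.List.Relation.Unary.All using ([]; _∷_)
open import Data.Maybe using (just)
import Data.Maybe as Maybe
open import Data.Maybe.Properties using (just-injective)
open import Data.Product.Function.NonDependent.Propositional using (_×-⇔_)
open import Data.Sum.Function.Propositional using (_⊎-⇔_)
open import Function using (_∘_; id)
open import Function.Bundles using (_⇔_; mk⇔; Equivalence; _↔_; Inverse; mk↔ₛ′)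
open import Function.Properties.Inverse using (↔-refl)
open import Function.Related.TypeIsomorphisms using (→-cong-⇔; ¬-cong-⇔)
open import Relation.Nullary using (¬_; Dec; yes; no; does)
open import Relation.Nullary.Decidable using (dec-true; dec-false; decidable-stable)
open import Relation.Unary using (Decidable)
open import Relation.Binary.PropositionalEquality
  using (_≡_; _≢_; refl; sym; trans; cong; subst; module ≡-Reasoning)

open Equivalence using (to; from)

∉-∷ : ∀ {x y : Var} {ys : List Var} → x ≢ y → x ∉ ys → x ∉ y ∷ ys
∉-∷ x≢y x∉ys (here x≡y)   = x≢y x≡y
∉-∷ x≢y x∉ys (there x∈ys) = x∉ys x∈ys

module Assignments {S : Signature} (R : Structure S) where
  open Structure R

  upd-≡ : ∀ ρ x d → upd S R ρ x d x ≡ d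
  upd-≡ ρ x d = cong (λ t → if t then d else ρ x) (dec-true (x ≟ⁿ x) refl)

  upd-≢ : ∀ ρ x d y → y ≢ x → upd S R ρ x d y ≡ ρ y
  upd-≢ ρ x d y y≢x = cong (λ t → if t then d else ρ y) (dec-false (y ≟ⁿ x) y≢x)

  updAll : (Var → D) → List Var → D → (Var → D)
  updAll ρ []       c = ρ
  updAll ρ (y ∷ ys) c = updAll (upd S R ρ y c) ys c

  updAll-∉ : ∀ ρ ys c x → x ∉ ys → updAll ρ ys c x ≡ ρ x
  updAll-∉ ρ []       c x x∉ = refl
  updAll-∉ ρ (y ∷ ys) c x x∉ =
    trans (updAll-∉ (upd S R ρ y c) ys c x (x∉ ∘ there)) (upd-≢ ρ y c x (x∉ ∘ here))

  updAll-∈ : ∀ ρ ys c x → x ∈ ys → updAll ρ ys c x ≡ c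
  updAll-∈ ρ (y ∷ ys) c x x∈ with x ∈? ys | x∈
  ... | yes x∈ys | _        = updAll-∈ (upd S R ρ y c) ys c x x∈ys
  ... | no x∉ys  | here refl =
    trans (updAll-∉ (upd S R ρ x c) ys c x x∉ys) (upd-≡ ρ x c)
  ... | no x∉ys  | there x∈ys = ⊥-elim (x∉ys x∈ys)

  updAll-const : ∀ {ρ c} ys θ Ψ → (∀ x → x ∉ ys → CFree S x θ → CFree S x Ψ) →
                 (∀ x → CFree S x Ψ → ρ x ≡ c) →
                 ∀ x → CFree S x θ → updAll ρ ys c x ≡ c
  updAll-const {ρ} {c} ys θ Ψ free-in-Ψ ρ≡c x x-free with x ∈? ys
  ... | yes x∈ys = updAll-∈ ρ ys c x x∈ys
  ... | no x∉ys  = trans (updAll-∉ ρ ys c x x∉ys) (ρ≡c x (free-in-Ψ x x∉ys x-free))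

  exs-intro : ∀ ρ ys c θ → CSat S R (updAll ρ ys c) θ → CSat S R ρ (exs S ys θ)
  exs-intro ρ []       c θ s = s
  exs-intro ρ (y ∷ ys) c θ s = c , exs-intro (upd S R ρ y c) ys c θ s

  exs-elim : ∀ ρ ys θ → CSat S R ρ (exs S ys θ) →
             Σ (Var → D) λ ρ′ → (∀ x → x ∉ ys → ρ′ x ≡ ρ x) × CSat S R ρ′ θ
  exs-elim ρ []       θ s       = ρ , (λ _ _ → refl) , s
  exs-elim ρ (y ∷ ys) θ (d , s) with exs-elim (upd S R ρ y d) ys θ s
  ... | ρ′ , ρ′≗ρ , s′ =
    ρ′ , (λ x x∉ → trans (ρ′≗ρ x (x∉ ∘ there)) (upd-≢ ρ y d x (x∉ ∘ here))) , s′

  alls-intro : ∀ ρ ys θ → (∀ ρ′ → CSat S R ρ′ θ) → CSat S R ρ (alls S ys θ)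
  alls-intro ρ []       θ h = h ρ
  alls-intro ρ (y ∷ ys) θ h = λ d → alls-intro (upd S R ρ y d) ys θ h

  alls-elim : ∀ ρ ys c θ → CSat S R ρ (alls S ys θ) → CSat S R (updAll ρ ys c) θ
  alls-elim ρ []       c θ s = s
  alls-elim ρ (y ∷ ys) c θ s = alls-elim (upd S R ρ y c) ys c θ (s c)

module FreeVariables (S : Signature) where
  open Signature S

  free-exs : ∀ {x} ys θ → x ∉ ys → CFree S x θ → CFree S x (exs S ys θ)
  free-exs []       θ x∉ f = f
  free-exs (y ∷ ys) θ x∉ f = x∉ ∘ here , free-exs ys θ (x∉ ∘ there) f

  free-alls : ∀ {x} ys θ → x ∉ ys → CFree S x θ → CFree S x (alls S ys θ)
  free-alls []       θ x∉ f = f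
  free-alls (y ∷ ys) θ x∉ f = x∉ ∘ here , free-alls ys θ (x∉ ∘ there) f

  free-exs⁻ : ∀ {x} ys θ → CFree S x (exs S ys θ) → x ∉ ys × CFree S x θ
  free-exs⁻ []       θ f         = (λ ()) , f
  free-exs⁻ (y ∷ ys) θ (x≢y , f) with free-exs⁻ ys θ f
  ... | x∉ys , f′ = ∉-∷ x≢y x∉ys , f′

  -- does argument a of r exist and get sent by v outside P?  Membership
  -- proofs in a subset are unique, so a single proof of a ∈ ar r decides this
  failsAt? : ∀ r {P : Var → Set} → Decidable P → (v : ArgsOf S r → Var) →
             (a : Fin nA) → Dec (Σ (a ∈ˢ ar r) λ a∈r → ¬ P (v (a , a∈r)))
  failsAt? r {P} P? v a with a ∈ˢ? ar r
  ... | no a∉r = no (a∉r ∘ proj₁)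
  ... | yes a∈r with P? (v (a , a∈r))
  ...   | yes Pv  = no λ (a∈r′ , ¬Pv) →
                      ¬Pv (subst (λ p → P (v (a , p))) ([]=-irrelevant a∈r a∈r′) Pv)
  ...   | no  ¬Pv = yes (a∈r , ¬Pv)

  searchArgs : ∀ r {P : Var → Set} → Decidable P → (v : ArgsOf S r → Var) →
               (Σ (ArgsOf S r) λ i → ¬ P (v i)) ⊎ (∀ i → P (v i))
  searchArgs r P? v with any? (failsAt? r P? v)
  ... | yes (a , a∈r , ¬Pv) = inj₁ ((a , a∈r) , ¬Pv)
  ... | no none = inj₂ λ (a , a∈r) →
                    decidable-stable (P? (v (a , a∈r))) λ ¬Pv → none (a , a∈r , ¬Pv)

  SomeOutside : List Var → (Var → Set) → Set
  SomeOutside L F = (Σ Var λ x → x ∉ L × F x) ⊎ (∀ x → x ∉ L → ¬ F x)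

  someOutside-≡ : ∀ L y → SomeOutside L (_≡ y)
  someOutside-≡ L y with y ∈? L
  ... | yes y∈L = inj₂ λ { x x∉L refl → x∉L y∈L }
  ... | no  y∉L = inj₁ (y , y∉L , refl)

  someOutside-⊎ : ∀ {L F G} → SomeOutside L F → SomeOutside L G →
                  SomeOutside L (λ x → F x ⊎ G x)
  someOutside-⊎ (inj₁ (x , x∉ , Fx)) _                    = inj₁ (x , x∉ , inj₁ Fx)
  someOutside-⊎ (inj₂ _)             (inj₁ (x , x∉ , Gx)) = inj₁ (x , x∉ , inj₂ Gx)
  someOutside-⊎ (inj₂ noF)           (inj₂ noG)           =
    inj₂ λ { x x∉ (inj₁ Fx) → noF x x∉ Fx ; x x∉ (inj₂ Gx) → noG x x∉ Gx }

  someOutside-bind : ∀ {L y F} → SomeOutside (y ∷ L) F → SomeOutside L (λ x → x ≢ y × F x)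
  someOutside-bind (inj₁ (x , x∉ , Fx)) = inj₁ (x , x∉ ∘ there , x∉ ∘ here , Fx)
  someOutside-bind (inj₂ none)          = inj₂ λ x x∉L (x≢y , Fx) → none x (∉-∷ x≢y x∉L) Fx

  -- whether a formula has a free variable outside L is decidable; this is
  -- what lets a pairwise-constant assignment pick its common value
  freeOutside : ∀ L ψ → SomeOutside L (λ x → CFree S x ψ)
  freeOutside L (atom r v) with searchArgs r (_∈? L) v
  ... | inj₁ (i , vi∉L) = inj₁ (v i , vi∉L , i , refl)
  ... | inj₂ all∈L      = inj₂ λ { x x∉L (i , refl) → x∉L (all∈L i) }
  freeOutside L (eq y z)  = someOutside-⊎ (someOutside-≡ L y) (someOutside-≡ L z)
  freeOutside L (neg ψ)   = freeOutside L ψ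
  freeOutside L (and ψ χ) = someOutside-⊎ (freeOutside L ψ) (freeOutside L χ)
  freeOutside L (or ψ χ)  = someOutside-⊎ (freeOutside L ψ) (freeOutside L χ)
  freeOutside L (imp ψ χ) = someOutside-⊎ (freeOutside L ψ) (freeOutside L χ)
  freeOutside L (ex y ψ)  = someOutside-bind (freeOutside (y ∷ L) ψ)
  freeOutside L (all y ψ) = someOutside-bind (freeOutside (y ∷ L) ψ)

-- (1) The point and the diagonal structures agree on CGFOL and GNFOL.

point : (S : Signature) → Structure S
point S = record { D = ⊤ ; d₀ = tt ; relI = λ _ _ → ⊤ ; relI-ext = λ _ _ _ _ _ → tt }

diagonal : (S : Signature) (D : Set) → D → Structure S
diagonal S D d = record
  { D = D ; d₀ = d ; relI = λ r f → ∀ i j → f i ≡ f j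
  ; relI-ext = λ r f g f≗g f-const i j → trans (sym (f≗g i)) (trans (f-const i j) (f≗g j)) }

module Collapse (S : Signature) (D : Set) (d₀ : D) where
  open Signature S
  open FreeVariables S
  private
    module Δ = Assignments (diagonal S D d₀)
    module Pt = Assignments (point S)

  SatΔ : (Var → D) → CFm S → Set
  SatΔ = CSat S (diagonal S D d₀)

  -- in the point every assignment is the unique one, so truth is absolute
  TruePt : CFm S → Set
  TruePt = CModels S (point S)

  ConstOn : (Var → D) → D → CFm S → Set
  ConstOn ρ c ψ = ∀ x → CFree S x ψ → ρ x ≡ c

  Pairwise : (Var → D) → CFm S → Set
  Pairwise ρ ψ = ∀ x y → CFree S x ψ → CFree S y ψ → ρ x ≡ ρ y

  pairwise⇒const : ∀ ρ ψ → Pairwise ρ ψ → Σ D λ c → ConstOn ρ c ψ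
  pairwise⇒const ρ ψ pw with freeOutside [] ψ
  ... | inj₁ (w , _ , w-free) = ρ w , λ x x-free → pw x w x-free w-free
  ... | inj₂ closed           = d₀ , λ x x-free → ⊥-elim (closed x (λ ()) x-free)

  atomic-const : ∀ {ρ c} α → IsAtomic S α → ConstOn ρ c α → SatΔ ρ α
  atomic-const (atom r v) _ ρ≡c i j = trans (ρ≡c _ (i , refl)) (sym (ρ≡c _ (j , refl)))
  atomic-const (eq x y)   _ ρ≡c     = trans (ρ≡c x (inj₁ refl)) (sym (ρ≡c y (inj₂ refl)))

  atomic-value : ∀ {ρ} α → IsAtomic S α → SatΔ ρ α → Σ D λ c → ConstOn ρ c α
  atomic-value {ρ} (atom r v) _ s = ρ (v (ar-ne r)) , λ { x (i , refl) → s i (ar-ne r) }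
  atomic-value {ρ} (eq x y)   _ s = ρ x , λ { z (inj₁ refl) → refl ; z (inj₂ refl) → sym s }

  atomic-pairwise : ∀ {ρ} α → IsAtomic S α → SatΔ ρ α → Pairwise ρ α
  atomic-pairwise α at s x y x-free y-free with atomic-value α at s
  ... | c , ρ≡c = trans (ρ≡c x x-free) (sym (ρ≡c y y-free))

  atomic-point : ∀ α → IsAtomic S α → TruePt α
  atomic-point (atom r v) _ = tt
  atomic-point (eq x y)   _ = refl

  conj-const : ∀ {ρ c} α → IsConjAtoms S α → ConstOn ρ c α → SatΔ ρ α
  conj-const (atom r v) _         = atomic-const (atom r v) tt
  conj-const (eq x y)   _         = atomic-const (eq x y) tt
  conj-const (and α β) (cα , cβ) h =
    conj-const α cα (λ x → h x ∘ inj₁) , conj-const β cβ (λ x → h x ∘ inj₂)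

  conj-point : ∀ α → IsConjAtoms S α → TruePt α
  conj-point (atom r v) _         = tt
  conj-point (eq x y)   _         = refl
  conj-point (and α β) (cα , cβ) = conj-point α cα , conj-point β cβ

  atomOf-pairwise : ∀ {ρ} β α → AtomOf S β α → SatΔ ρ α → Pairwise ρ β
  atomOf-pairwise β (atom r v) refl s          = atomic-pairwise β tt s
  atomOf-pairwise β (eq x y)   refl s          = atomic-pairwise β tt s
  atomOf-pairwise β (and α α′) (inj₁ β∈α) (s , _) = atomOf-pairwise β α β∈α s
  atomOf-pairwise β (and α α′) (inj₂ β∈α) (_ , s) = atomOf-pairwise β α′ β∈α s

  -- clique formulas: every two free variables share an atom, hence a value
  clique-pairwise : ∀ {ρ} γ → IsCliqueFormula S γ → SatΔ ρ γ → Pairwise ρ γ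
  clique-pairwise {ρ} .(exs S zs α) (zs , α , refl , _ , clique) s x y x-free y-free
    with Δ.exs-elim ρ zs α s | clique x y x-free y-free
  ... | ρ′ , ρ′≗ρ , sα | β , β∈α , x∈β , y∈β = begin
    ρ x  ≡⟨ sym (ρ′≗ρ x (proj₁ (free-exs⁻ zs α x-free))) ⟩
    ρ′ x ≡⟨ atomOf-pairwise β α β∈α sα x y x∈β y∈β ⟩
    ρ′ y ≡⟨ ρ′≗ρ y (proj₁ (free-exs⁻ zs α y-free)) ⟩
    ρ y  ∎
    where open ≡-Reasoning

  -- a clique formula holds on a constant assignment (its bound variables get
  -- the same value too), and it holds in the point
  clique-const : ∀ {ρ c} γ → IsCliqueFormula S γ → ConstOn ρ c γ → SatΔ ρ γ
  clique-const {ρ} {c} .(exs S zs α) (zs , α , refl , conj , _) ρ≡c =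
    Δ.exs-intro ρ zs c α (conj-const α conj
      (Δ.updAll-const zs α (exs S zs α) (λ x x∉ → free-exs zs α x∉) ρ≡c))

  clique-point : ∀ γ → IsCliqueFormula S γ → TruePt γ
  clique-point .(exs S zs α) (zs , α , refl , conj , _) =
    Pt.exs-intro _ zs tt α (conj-point α conj)

  guarded-const : ∀ {ρ} γ φ → IsCliqueFormula S γ → (S ⊆fv φ) γ → SatΔ ρ γ →
                  Σ D λ c → ConstOn ρ c φ
  guarded-const {ρ} γ φ cq φ⊆γ sγ =
    pairwise⇒const ρ φ λ x y x-free y-free →
      clique-pairwise γ cq sγ x y (φ⊆γ x x-free) (φ⊆γ y y-free)

  cg-collapse : ∀ {ψ} → IsCGFOL S ψ → ∀ {ρ c} → ConstOn ρ c ψ → SatΔ ρ ψ ⇔ TruePt ψ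
  cg-collapse (atomic {α} at) h = mk⇔ (λ _ → atomic-point α at) (λ _ → atomic-const α at h)
  cg-collapse (neg p)   h = ¬-cong-⇔ (cg-collapse p h)
  cg-collapse (and p q) h = cg-collapse p (λ x → h x ∘ inj₁) ×-⇔ cg-collapse q (λ x → h x ∘ inj₂)
  cg-collapse (or p q)  h = cg-collapse p (λ x → h x ∘ inj₁) ⊎-⇔ cg-collapse q (λ x → h x ∘ inj₂)
  cg-collapse (imp p q) h = →-cong-⇔ (cg-collapse p (λ x → h x ∘ inj₁)) (cg-collapse q (λ x → h x ∘ inj₂))
  cg-collapse (gex ys {γ} {φ} cq φ⊆γ p) {ρ} {c} h = mk⇔ toPt fromPt
    where
    toPt : SatΔ ρ (exs S ys (and γ φ)) → TruePt (exs S ys (and γ φ))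
    toPt s with Δ.exs-elim ρ ys (and γ φ) s
    ... | ρ′ , _ , sγ , sφ with guarded-const γ φ cq φ⊆γ sγ
    ...   | c′ , ρ′≡c′ = Pt.exs-intro _ ys tt (and γ φ)
                           (clique-point γ cq , to (cg-collapse p ρ′≡c′) sφ)
    γ-const : ConstOn (Δ.updAll ρ ys c) c γ
    γ-const = Δ.updAll-const ys γ (exs S ys (and γ φ)) (λ x x∉ → free-exs ys (and γ φ) x∉ ∘ inj₁) h
    fromPt : TruePt (exs S ys (and γ φ)) → SatΔ ρ (exs S ys (and γ φ))
    fromPt t = Δ.exs-intro ρ ys c (and γ φ)
      ( clique-const γ cq γ-const
      , from (cg-collapse p (λ x → γ-const x ∘ φ⊆γ x))
             (proj₂ (proj₂ (proj₂ (Pt.exs-elim _ ys (and γ φ) t)))) )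
  cg-collapse (gall ys {γ} {φ} cq φ⊆γ p) {ρ} {c} h = mk⇔ toPt fromPt
    where
    γ-const : ConstOn (Δ.updAll ρ ys c) c γ
    γ-const = Δ.updAll-const ys γ (alls S ys (imp γ φ)) (λ x x∉ → free-alls ys (imp γ φ) x∉ ∘ inj₁) h
    toPt : SatΔ ρ (alls S ys (imp γ φ)) → TruePt (alls S ys (imp γ φ))
    toPt s = Pt.alls-intro _ ys (imp γ φ) λ _ _ →
      to (cg-collapse p (λ x → γ-const x ∘ φ⊆γ x))
         (Δ.alls-elim ρ ys c (imp γ φ) s (clique-const γ cq γ-const))
    fromPt : TruePt (alls S ys (imp γ φ)) → SatΔ ρ (alls S ys (imp γ φ))
    fromPt t = Δ.alls-intro ρ ys (imp γ φ) λ ρ′ sγ →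
      from (cg-collapse p (proj₂ (guarded-const γ φ cq φ⊆γ sγ)))
           (Pt.alls-elim _ ys tt (imp γ φ) t (clique-point γ cq))

  -- the collapse theorem for GNFOL; GNFOL formulas are positive outside
  -- guarded negations, so the transfer to the point needs no hypothesis
  gn-to-point   : ∀ {ψ} → IsGNFOL S ψ → ∀ ρ → SatΔ ρ ψ → TruePt ψ
  gn-from-point : ∀ {ψ} → IsGNFOL S ψ → ∀ {ρ c} → ConstOn ρ c ψ → TruePt ψ → SatΔ ρ ψ

  gn-to-point (atom r v) ρ _ = tt
  gn-to-point (eq x y)   ρ _ = refl
  gn-to-point (ex x p)   ρ (d , s) = tt , gn-to-point p _ s
  gn-to-point (and p q)  ρ (s , s′) = gn-to-point p ρ s , gn-to-point q ρ s′
  gn-to-point (or p q)   ρ (inj₁ s) = inj₁ (gn-to-point p ρ s)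
  gn-to-point (or p q)   ρ (inj₂ s) = inj₂ (gn-to-point q ρ s)
  gn-to-point (gneg {α} {φ} at φ⊆α p) ρ (sα , ¬sφ) with atomic-value α at sα
  ... | c , ρ≡c = atomic-point α at , λ tφ → ¬sφ (gn-from-point p (λ x → ρ≡c x ∘ φ⊆α x) tφ)

  gn-from-point (atom r v) h _ = atomic-const (atom r v) tt h
  gn-from-point (eq x y)   h _ = atomic-const (eq x y) tt h
  gn-from-point (ex x {φ} p) {ρ} {c} h (_ , t) =
    c , gn-from-point p (Δ.updAll-const (x ∷ []) φ (ex x φ) (λ z z∉ → z∉ ∘ here ,_) h) t
  gn-from-point (and p q) h (t , t′) =
    gn-from-point p (λ x → h x ∘ inj₁) t , gn-from-point q (λ x → h x ∘ inj₂) t′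
  gn-from-point (or p q) h (inj₁ t) = inj₁ (gn-from-point p (λ x → h x ∘ inj₁) t)
  gn-from-point (or p q) h (inj₂ t) = inj₂ (gn-from-point q (λ x → h x ∘ inj₂) t)
  gn-from-point (gneg {α} at φ⊆α p) {ρ} h (_ , ¬tφ) =
    atomic-const α at (λ x → h x ∘ inj₁) , λ sφ → ¬tφ (gn-to-point p ρ sφ)

  cg-transfer : ∀ {ψ} → IsCGFOL S ψ → TruePt ψ → CModels S (diagonal S D d₀) ψ
  cg-transfer p = from (cg-collapse p λ _ _ → refl)

  gn-transfer : ∀ {ψ} → IsGNFOL S ψ → TruePt ψ → CModels S (diagonal S D d₀) ψ
  gn-transfer p = gn-from-point p λ _ _ → refl

-- (2) OBFOL is invariant under reduct-wise isomorphisms.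

module Relations (S : Signature) where
  open Signature S

  Every : (Rels S → Set) → Fm S → Set
  Every P (rel r)      = P r
  Every P (neg φ)      = Every P φ
  Every P (and φ ψ)    = Every P φ × Every P ψ
  Every P (or φ ψ)     = Every P φ × Every P ψ
  Every P (ex _ φ)     = Every P φ
  Every P (all _ φ)    = Every P φ
  Every P (bind _ _ φ) = Every P φ

  every-mono : ∀ {P Q} → (∀ r → P r → Q r) → ∀ φ → Every P φ → Every Q φ
  every-mono P⇒Q (rel r)      e         = P⇒Q r e
  every-mono P⇒Q (neg φ)      e         = every-mono P⇒Q φ e
  every-mono P⇒Q (and φ ψ)    (e , e′) = every-mono P⇒Q φ e , every-mono P⇒Q ψ e′
  every-mono P⇒Q (or φ ψ)     (e , e′) = every-mono P⇒Q φ e , every-mono P⇒Q ψ e′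
  every-mono P⇒Q (ex _ φ)     e         = every-mono P⇒Q φ e
  every-mono P⇒Q (all _ φ)    e         = every-mono P⇒Q φ e
  every-mono P⇒Q (bind _ _ φ) e         = every-mono P⇒Q φ e

  every-derived : ∀ X φ → IsDerivedOn S X φ → Every (λ r → ar r ≡ X) φ
  every-derived X (rel r)   ar≡X     = ar≡X
  every-derived X (neg φ)   d        = every-derived X φ d
  every-derived X (and φ ψ) (d , d′) = every-derived X φ d , every-derived X ψ d′
  every-derived X (or φ ψ)  (d , d′) = every-derived X φ d , every-derived X ψ d′

  every-prefix : ∀ {P} ℘ ♭ φ → Every P φ → Every P (applyQ S ℘ (applyB S ♭ φ))
  every-prefix []              []            φ e = e
  every-prefix []              ((a , x) ∷ ♭) φ e = every-prefix [] ♭ φ e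
  every-prefix ((∃q , x) ∷ ℘) ♭             φ e = every-prefix ℘ ♭ φ e
  every-prefix ((∀q , x) ∷ ℘) ♭             φ e = every-prefix ℘ ♭ φ e

module Isomorphism {S : Signature} (A B : Structure S) where
  open Signature S
  open Relations S
  open Structure A using () renaming (D to DA; relI to relA)
  open Structure B using () renaming (D to DB; relI to relB; relI-ext to relB-ext)

  Preserves : DA ↔ DB → Rels S → Set
  Preserves h r = ∀ g → relA r g ⇔ relB r (Inverse.to h ∘ g)

  ReductIso : Subset nA → Set
  ReductIso X = Σ (DA ↔ DB) λ h → ∀ r → ar r ≡ X → Preserves h r

  module Transport (h : DA ↔ DB) where
    open Inverse h using (strictlyInverseˡ; strictlyInverseʳ) renaming (to to ι; from to ι⁻¹)

    Related : PAssign S DA → PAssign S DB → Set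
    Related χ χ′ = (∀ a → PAssign.onArg χ′ a ≡ Maybe.map ι (PAssign.onArg χ a))
                 × (∀ x → PAssign.onVar χ′ x ≡ Maybe.map ι (PAssign.onVar χ x))

    related-empty : Related (emptyPA S) (emptyPA S)
    related-empty = (λ _ → refl) , (λ _ → refl)

    related-setVar : ∀ {χ χ′} x {d d′} → Related χ χ′ → ι d ≡ d′ →
                     Related (setVar S χ x d) (setVar S χ′ x d′)
    related-setVar {χ} {χ′} x {d} {d′} (onArg≡ , onVar≡) ιd≡d′ = onArg≡ , λ y → pick y (does (y ≟ⁿ x))
      where
      pick : ∀ y b → (if b then just d′ else PAssign.onVar χ′ y)
                   ≡ Maybe.map ι (if b then just d else PAssign.onVar χ y)
      pick y true  = cong just (sym ιd≡d′)
      pick y false = onVar≡ y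

    related-setArg : ∀ {χ χ′} a x → Related χ χ′ →
                     Related (setArg S χ a (PAssign.onVar χ x)) (setArg S χ′ a (PAssign.onVar χ′ x))
    related-setArg {χ} {χ′} a x (onArg≡ , onVar≡) = (λ b → pick b (does (b ≟ᶠ a))) , onVar≡
      where
      pick : ∀ b t → (if t then PAssign.onVar χ′ x else PAssign.onArg χ′ b)
                   ≡ Maybe.map ι (if t then PAssign.onVar χ x else PAssign.onArg χ b)
      pick b true  = onVar≡ x
      pick b false = onArg≡ b

    map-just : ∀ m b → Maybe.map ι m ≡ just b → m ≡ just (ι⁻¹ b)
    map-just (just a) _ refl = cong just (sym (strictlyInverseʳ a))

    sat-iso : ∀ φ → Every (Preserves h) φ → ∀ {χ χ′} → Related χ χ′ →
              Sat S A χ φ ⇔ Sat S B χ′ φ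
    sat-iso (rel r) pres {χ} {χ′} (onArg≡ , _) = mk⇔ toB fromB
      where
      toB : Sat S A χ (rel r) → Sat S B χ′ (rel r)
      toB (g , χ≡g , Ag) =
        ι ∘ g , (λ i → trans (onArg≡ (proj₁ i)) (cong (Maybe.map ι) (χ≡g i))) , to (pres g) Ag
      fromB : Sat S B χ′ (rel r) → Sat S A χ (rel r)
      fromB (g′ , χ′≡g′ , Bg′) =
        ι⁻¹ ∘ g′ ,
        (λ i → map-just _ _ (trans (sym (onArg≡ (proj₁ i))) (χ′≡g′ i))) ,
        from (pres (ι⁻¹ ∘ g′)) (relB-ext r g′ _ (λ i → sym (strictlyInverseˡ (g′ i))) Bg′)
    sat-iso (neg φ)   pres           χ~χ′ = ¬-cong-⇔ (sat-iso φ pres χ~χ′)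
    sat-iso (and φ ψ) (pres , pres′) χ~χ′ = sat-iso φ pres χ~χ′ ×-⇔ sat-iso ψ pres′ χ~χ′
    sat-iso (or φ ψ)  (pres , pres′) χ~χ′ = sat-iso φ pres χ~χ′ ⊎-⇔ sat-iso ψ pres′ χ~χ′
    sat-iso (ex x φ) pres {χ} {χ′} χ~χ′ = mk⇔
      (λ (d , s) → ι d , to (sat-iso φ pres (related-setVar {χ} {χ′} x χ~χ′ refl)) s)
      (λ (d′ , s) → ι⁻¹ d′ ,
         from (sat-iso φ pres (related-setVar {χ} {χ′} x χ~χ′ (strictlyInverseˡ d′))) s)
    sat-iso (all x φ) pres {χ} {χ′} χ~χ′ = mk⇔
      (λ s d′ → to (sat-iso φ pres (related-setVar {χ} {χ′} x χ~χ′ (strictlyInverseˡ d′))) (s (ι⁻¹ d′)))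
      (λ s d → from (sat-iso φ pres (related-setVar {χ} {χ′} x χ~χ′ refl)) (s (ι d)))
    sat-iso (bind a x φ) pres {χ} {χ′} χ~χ′ = sat-iso φ pres (related-setArg {χ} {χ′} a x χ~χ′)

  obfol-invariant : (∀ X → ReductIso X) → ∀ {φ} → IsOBFOL S φ → Models S A φ ⇔ Models S B φ
  obfol-invariant iso (basic ℘ ♭ r̄ _ _ (X , r̄-on-X)) with iso X
  ... | h , pres = Transport.sat-iso h (applyQ S ℘ (applyB S ♭ r̄))
                     (every-prefix ℘ ♭ r̄ (every-mono pres r̄ (every-derived X r̄ r̄-on-X)))
                     (Transport.related-empty h)
  obfol-invariant iso (and p q) = obfol-invariant iso p ×-⇔ obfol-invariant iso q
  obfol-invariant iso (or p q)  = obfol-invariant iso p ⊎-⇔ obfol-invariant iso q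

not-expressible-in-fragment :
  ∀ {S} (A B : Structure S) (Frag : CFm S → Set) {Extra : CFm S → Set} {φ : Fm S} →
  (∀ {ψ} → Frag ψ → CModels S A ψ → CModels S B ψ) → Models S A φ → ¬ Models S B φ →
  ¬ (Σ (CFm S) λ ψ → Frag ψ × Extra ψ × Equiv S φ ψ)
not-expressible-in-fragment A B Frag transfer Aφ ¬Bφ (ψ , ψ∈Frag , _ , φ≡ψ) =
  ¬Bφ (proj₂ (φ≡ψ B) (transfer ψ∈Frag (proj₁ (φ≡ψ A) Aφ)))

not-expressible-in-OBFOL :
  ∀ {S} (A B : Structure S) {ψ : CFm S} →
  (∀ {φ} → IsOBFOL S φ → Models S A φ → Models S B φ) → CModels S A ψ → ¬ CModels S B ψ →
  ¬ (Σ (Fm S) λ φ → IsOBFOL S φ × Sentence S φ × Equiv S φ ψ)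
not-expressible-in-OBFOL A B transfer Aψ ¬Bψ (φ , φ-ob , _ , φ≡ψ) =
  ¬Bψ (proj₁ (φ≡ψ B) (transfer φ-ob (proj₂ (φ≡ψ A) Aψ)))

-- The concrete signature: arguments a, b; a unary P on a, a binary R on a, b.

pattern argA = zero
pattern argB = suc zero
pattern P    = zero
pattern R    = suc zero

arity : Fin 2 → Subset 2
arity P = inside ∷ outside ∷ []
arity R = inside ∷ inside ∷ []

σ : Signature
σ = record { nA = 2 ; nR = 2 ; arg₀ = argA ; rel₀ = P ; ar = arity ; ar-ne = arity-ne }
  where
  arity-ne : ∀ r → Nonempty (arity r)
  arity-ne P = argA , Vec.here
  arity-ne R = argA , Vec.here

P₁ : ArgsOf σ P
P₁ = argA , Vec.here

R₁ R₂ : ArgsOf σ R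
R₁ = argA , Vec.here
R₂ = argB , Vec.there Vec.here

true≢false : true ≢ false
true≢false ()

totalR : Fm σ
totalR = applyQ σ ((∀q , 0) ∷ (∀q , 1) ∷ []) (applyB σ ((argA , 0) ∷ (argB , 1) ∷ []) (rel R))

totalR-OBFOL : IsOBFOL σ totalR
totalR-OBFOL = basic _ _ _ (((λ ()) ∷ []) ∷ [] ∷ []) (((λ ()) ∷ []) ∷ [] ∷ []) (arity R , refl)

totalR-sentence : Sentence σ totalR
totalR-sentence =
  (λ { x (x≢0 , x≢1 , inj₁ x≡0) → x≢0 x≡0 ; x (x≢0 , x≢1 , inj₂ (inj₁ x≡1)) → x≢1 x≡1 }) ,
  (λ { argA (a≢a , _) → a≢a refl ; argB (_ , b≢b , _) → b≢b refl })

-- totalR holds in the point but not in the diagonal structure on Bool,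
-- where R(true, false) fails
totalR-point : Models σ (point σ) totalR
totalR-point _ _ = _ , (λ { (argA , Vec.here) → refl ; (argB , Vec.there Vec.here) → refl }) , tt

totalR-diagonal : ¬ Models σ (diagonal σ Bool true) totalR
totalR-diagonal totality with totality true false
... | g , χ≡g , g-const = true≢false (begin
  true ≡⟨ just-injective (χ≡g R₁) ⟩
  g R₁ ≡⟨ g-const R₁ R₂ ⟩
  g R₂ ≡⟨ sym (just-injective (χ≡g R₂)) ⟩
  false ∎)
  where open ≡-Reasoning

loopAt : Bool → Structure σ
loopAt b = record { D = Bool ; d₀ = true ; relI = rel′ ; relI-ext = rel′-ext }
  where
  rel′ : (r : Fin 2) → (ArgsOf σ r → Bool) → Set
  rel′ P g = g P₁ ≡ true
  rel′ R g = (g R₁ ≡ b) × (g R₂ ≡ b)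
  rel′-ext : ∀ r (f g : ArgsOf σ r → Bool) → (∀ i → f i ≡ g i) → rel′ r f → rel′ r g
  rel′-ext P f g f≗g fP        = trans (sym (f≗g P₁)) fP
  rel′-ext R f g f≗g (f₁ , f₂) = trans (sym (f≗g R₁)) f₁ , trans (sym (f≗g R₂)) f₂

-- negation swaps the R-conditions of the two structures
≡true⇔not≡false : ∀ b → b ≡ true ⇔ not b ≡ false
≡true⇔not≡false true  = mk⇔ (λ _ → refl) (λ _ → refl)
≡true⇔not≡false false = mk⇔ (λ ()) (λ ())

loop-reductIso : ∀ X → Isomorphism.ReductIso (loopAt true) (loopAt false) X
loop-reductIso (inside ∷ inside ∷ []) = negation , λ
  { R refl g → ≡true⇔not≡false (g R₁) ×-⇔ ≡true⇔not≡false (g R₂) ; P () }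
  where
  negation : Bool ↔ Bool
  negation = mk↔ₛ′ not not not-involutive not-involutive
loop-reductIso (inside ∷ outside ∷ []) = ↔-refl , λ { P refl g → mk⇔ id id ; R () }
loop-reductIso (outside ∷ _ ∷ [])      = ↔-refl , λ { P () ; R () }

guardR : CFm σ
guardR = atom R λ { (argA , _) → 0 ; (argB , _) → 1 }

atP : CFm σ
atP = atom P λ _ → 0

loopInP : CFm σ
loopInP = exs σ (0 ∷ 1 ∷ []) (and guardR atP)

atP⊆guardR : (σ ⊆fv atP) guardR
atP⊆guardR x (_ , refl) = R₁ , refl

loopInP-GFOL : IsGFOL σ loopInP
loopInP-GFOL = gex (0 ∷ 1 ∷ []) tt atP⊆guardR (atomic tt)

loopInP-CGFOL : IsCGFOL σ loopInP
loopInP-CGFOL = gex (0 ∷ 1 ∷ [])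
  ([] , guardR , refl , tt , λ x y x-free y-free → guardR , refl , x-free , y-free)
  atP⊆guardR (atomic tt)

loopInP-GNFOL : IsGNFOL σ loopInP
loopInP-GNFOL = ex 0 (ex 1 (and (atom _ _) (atom _ _)))

loopInP-sentence : CSentence σ loopInP
loopInP-sentence x (x≢0 , x≢1 , inj₁ ((argA , _) , refl)) = x≢0 refl
loopInP-sentence x (x≢0 , x≢1 , inj₁ ((argB , _) , refl)) = x≢1 refl
loopInP-sentence x (x≢0 , x≢1 , inj₂ (_ , refl))           = x≢0 refl

loopInP-true : CModels σ (loopAt true) loopInP
loopInP-true = true , true , (refl , refl) , refl

loopInP-false : ¬ CModels σ (loopAt false) loopInP
loopInP-false (_ , _ , (x≡false , _) , x≡true) = true≢false (trans (sym x≡true) x≡false)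

mainTheorem6 :
  (Σ Signature λ S → Σ (Fm S) λ φ →
      IsOBFOL S φ × Sentence S φ ×
      ¬ (Σ (CFm S) λ ψ → IsCGFOL S ψ × CSentence S ψ × Equiv S φ ψ) ×
      ¬ (Σ (CFm S) λ ψ → IsGNFOL S ψ × CSentence S ψ × Equiv S φ ψ))
  ×
  (Σ Signature λ S → Σ (CFm S) λ ψ →
      IsGFOL S ψ × IsCGFOL S ψ × IsGNFOL S ψ × CSentence S ψ ×
      ¬ (Σ (Fm S) λ φ → IsOBFOL S φ × Sentence S φ × Equiv S φ ψ))
mainTheorem6 =
  ( σ , totalR , totalR-OBFOL , totalR-sentence
  , not-expressible-in-fragment (point σ) diagonal₂ (IsCGFOL σ) {φ = totalR}
      cg-transfer totalR-point totalR-diagonal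
  , not-expressible-in-fragment (point σ) diagonal₂ (IsGNFOL σ) {φ = totalR}
      gn-transfer totalR-point totalR-diagonal )
  ,
  ( σ , loopInP , loopInP-GFOL , loopInP-CGFOL , loopInP-GNFOL , loopInP-sentence
  , not-expressible-in-OBFOL (loopAt true) (loopAt false) {ψ = loopInP}
      (to ∘ Isomorphism.obfol-invariant (loopAt true) (loopAt false) loop-reductIso)
      loopInP-true loopInP-false )
  where
  diagonal₂ : Structure σ
  diagonal₂ = diagonal σ Bool true
  open Collapse σ Bool true using (cg-transfer; gn-transfer)
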